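{- Every special path is $S$-perfect.
   Context: A special path $P^*$ is obtained from a path $P$ by making an edge of $P$ lie in a free triangle, i.e., by adding a new vertex adjacent exactly to the two endpoints of an edge of $P$. A star is a tree with one vertex adjacent to all others ($K_1,K_2$ included). $\theta_S(G)$ is the minimum number of star subgraphs of $G$ covering $V(G)$; $T\subseteq V(G)$ is $S$-independent if no two of its vertices lie in a common star subgraph (pairwise distance at least $3$), and $\alpha_S(G)$ is the maximum size of such a set. $G$ is $S$-perfect if $\alpha_S(H)=\theta_S(H)$ for every induced subgraph $H$. -}

module Defs where

open import Data.Nat using (ℕ; zero; suc; _<_)
open import Data.Fin using (Fin; toℕ)
open import Data.Fin.Subset using (Subset; _∈_)
open import Data.List using (List; length)
open import Data.List.Relation.Unary.All using (All)
open import Data.List.Relation.Unary.Unique.Propositional using (Unique)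
import Data.List.Membership.Propositional as LM
open import Data.Vec using (Vec)
import Data.Vec.Membership.Propositional as VM
open import Data.Product using (Σ; _×_; ∃)
open import Data.Sum using (_⊎_)
open import Relation.Binary.PropositionalEquality using (_≡_; _≢_)
open import Relation.Nullary using (¬_)

-- All notions below are relative to an adjacency relation Adj on Fin n and a
-- vertex set H : Subset n; "in H" means "in the induced subgraph G[H]".

module _ {n : ℕ} (Adj : Fin n → Fin n → Set) where

  -- A star subgraph of G[H]: a centre c and a list of distinct leaves, all in H,
  -- every leaf adjacent to c.  (No leaves = K1, one leaf = K2.)
  record Star (H : Subset n) : Set where
    field
      centre      : Fin n
      leaves      : List (Fin n)
      centre∈H    : centre ∈ H
      leaves∈H    : All (λ v → v ∈ H) leaves
      leavesAdj   : All (λ v → Adj centre v) leaves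
      leavesDist  : Unique leaves
      centre∉     : ¬ (centre LM.∈ leaves)

  InStar : {H : Subset n} → Star H → Fin n → Set
  InStar s v = (v ≡ Star.centre s) ⊎ (v LM.∈ Star.leaves s)

  StarCover : (H : Subset n) → ℕ → Set
  StarCover H k = Σ (Vec (Star H) k) λ ss →
    (v : Fin n) → v ∈ H → ∃ λ s → s VM.∈ ss × InStar s v

  IsθS : Subset n → ℕ → Set
  IsθS H t = StarCover H t × ((k : ℕ) → k < t → ¬ StarCover H k)

  SIndependent : Subset n → List (Fin n) → Set
  SIndependent H T =
    Unique T × All (λ v → v ∈ H) T ×
    ((u v : Fin n) → u LM.∈ T → v LM.∈ T → u ≢ v →
       ¬ (Σ (Star H) λ s → InStar s u × InStar s v))

  IsαS : Subset n → ℕ → Set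
  IsαS H a = (Σ (List (Fin n)) λ T → SIndependent H T × length T ≡ a)
           × ((T : List (Fin n)) → SIndependent H T → ¬ (a < length T))

  SPerfect : Set
  SPerfect = (H : Subset n) (a t : ℕ) → IsαS H a → IsθS H t → a ≡ t

-- The special path P_m^* (up to isomorphism): path 0 - 1 - ... - (m-1) on
-- vertices 0..m-1, plus a new vertex m adjacent exactly to i and i+1,
-- where {i, i+1} is an edge of the path (so suc i < m).
SPAdjℕ : ℕ → ℕ → ℕ → ℕ → Set
SPAdjℕ m i a b =
    (a < m × b < m × (suc a ≡ b ⊎ suc b ≡ a))
  ⊎ (a ≡ m × (b ≡ i ⊎ b ≡ suc i))
  ⊎ (b ≡ m × (a ≡ i ⊎ a ≡ suc i))

SpecialPathAdj : (m i : ℕ) → Fin (suc m) → Fin (suc m) → Set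
SpecialPathAdj m i u v = SPAdjℕ m i (toℕ u) (toℕ v)

{-# OPTIONS --safe #-}
-- Placing the new vertex between the ends of its edge turns P_m^* into the path 0 - 1 - ⋯ - m
-- with the chord {i, i + 2}.  For any vertex set H a left-to-right greedy pass then produces an
-- S-independent set and a star cover of the same size: take the leftmost unprocessed vertex x of
-- H, cover it by a star centred at its farthest neighbour in H, which swallows every vertex of H
-- that is within distance 2 of x, and continue to the right of that star.  As an S-independent
-- set meets each star at most once, α_S ≤ θ_S always, so both equal the size of the greedy set.
module Submission where

open import Data.Nat
open import Data.Nat.Properties
open import Data.Maybe using (Maybe; just; nothing)
open import Data.Product
open import Data.Sum using (_⊎_; inj₁; inj₂)
open import Data.Empty
open import Function using (_∘_)
open import Relation.Nullary
open import Relation.Nullary.Decidable using (False; toWitnessFalse; _×-dec_; ¬?)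
open import Relation.Unary using (Decidable)
open import Relation.Binary.PropositionalEquality
open import Relation.Binary.Definitions using (tri<; tri≈; tri>)
open import Defs
open import Data.Fin as Fin using (Fin; toℕ)
open import Data.Fin.Subset using (Subset; _∈_)
open import Data.Fin.Subset.Properties using (_∈?_)
open import Data.List using (List; []; _∷_; length; filter; allFin; lookup)
open import Data.List.Relation.Unary.All as All using (All; []; _∷_)
open import Data.List.Relation.Unary.All.Properties using (all-filter)
open import Data.List.Relation.Unary.Unique.Propositional using (Unique)
open import Data.List.Relation.Unary.Unique.Propositional.Properties using (filter⁺; allFin⁺)
open import Data.List.Relation.Unary.AllPairs using ([]; _∷_)
open import Data.List.Membership.Propositional using () renaming (_∈_ to _∈ₗ_)
open import Data.List.Membership.Propositional.Properties using (∈-filter⁺; ∈-filter⁻; ∈-allFin; ∈-lookup)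
open import Data.List.Relation.Unary.Any using (here; there)
open import Data.Vec as Vec using (Vec; []; _∷_)
import Data.Vec.Relation.Unary.Any as VecAny
open import Data.Vec.Relation.Unary.Any.Properties using (lookup-index)
import Data.Vec.Membership.Propositional as VecMem
import Data.Fin.Properties as Finₚ

Unique⇒lookup-injective : ∀ {a} {A : Set a} {xs : List A} → Unique xs →
                          ∀ j k → j ≢ k → lookup xs j ≢ lookup xs k
Unique⇒lookup-injective (_ ∷ _)  Fin.zero    Fin.zero    j≢k = ⊥-elim (j≢k refl)
Unique⇒lookup-injective (x∉ ∷ _) Fin.zero    (Fin.suc k) _   = All.lookup x∉ (∈-lookup k)
Unique⇒lookup-injective (x∉ ∷ _) (Fin.suc j) Fin.zero    _   = All.lookup x∉ (∈-lookup j) ∘ sym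
Unique⇒lookup-injective (_ ∷ u)  (Fin.suc j) (Fin.suc k) j≢k = Unique⇒lookup-injective u j k (j≢k ∘ cong Fin.suc)

module _ {n : ℕ} {Adj : Fin n → Fin n → Set} {H : Subset n} where

  SIndependent-length≤StarCover : ∀ {T t} → SIndependent Adj H T → StarCover Adj H t → length T ≤ t
  SIndependent-length≤StarCover {T} {t} (unique , T⊆H , separated) (stars , covers) = ≮⇒≥ collision
    where
    coveringStar : (j : Fin (length T)) → ∃ λ s → s VecMem.∈ stars × InStar Adj s (lookup T j)
    coveringStar j = covers (lookup T j) (All.lookup T⊆H (∈-lookup j))

    slot : Fin (length T) → Fin t
    slot j = VecAny.index (proj₁ (proj₂ (coveringStar j)))

    star-at-slot : ∀ j → proj₁ (coveringStar j) ≡ Vec.lookup stars (slot j)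
    star-at-slot j = lookup-index (proj₁ (proj₂ (coveringStar j)))

    collision : t < length T → ⊥
    collision t<|T| with Finₚ.pigeonhole t<|T| slot
    ... | j , k , j<k , same-slot =
      separated _ _ (∈-lookup j) (∈-lookup k)
        (Unique⇒lookup-injective unique j k (λ { refl → Finₚ.<-irrefl refl j<k }))
        (proj₁ (coveringStar j) , proj₂ (proj₂ (coveringStar j)) ,
         subst (λ s → InStar Adj s (lookup T k)) same-star (proj₂ (proj₂ (coveringStar k))))
      where
      same-star : proj₁ (coveringStar k) ≡ proj₁ (coveringStar j)
      same-star = trans (star-at-slot k) (trans (cong (Vec.lookup stars) (sym same-slot)) (sym (star-at-slot j)))

SPerfect-from-certificates : ∀ {n} (Adj : Fin n → Fin n → Set) →
  (∀ H → ∃ λ T → SIndependent Adj H T × StarCover Adj H (length T)) → SPerfect Adj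
SPerfect-from-certificates Adj certify H a t ((T , independent , refl) , maximal) (cover , minimal)
  with certify H
... | T* , independent* , cover* =
  ≤-antisym (SIndependent-length≤StarCover independent cover)
            (≤-trans (≮⇒≥ λ lt → minimal _ lt cover*) (≮⇒≥ (maximal T* independent*)))

-- The path 0 - 1 - 2 - ⋯ on ℕ, with the extra edge {j, 2 + j} when the chord is just j.
Chord : Maybe ℕ → ℕ → ℕ → Set
Chord o a b = o ≡ just a × b ≡ 2 + a

Link : Maybe ℕ → ℕ → ℕ → Set
Link o a b = suc a ≡ b ⊎ suc b ≡ a ⊎ Chord o a b ⊎ Chord o b a

Link-sym : ∀ {o a b} → Link o a b → Link o b a
Link-sym (inj₁ e)                = inj₂ (inj₁ e)
Link-sym (inj₂ (inj₁ e))         = inj₁ e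
Link-sym (inj₂ (inj₂ (inj₁ c)))  = inj₂ (inj₂ (inj₂ c))
Link-sym (inj₂ (inj₂ (inj₂ c)))  = inj₂ (inj₂ (inj₁ c))

≤-absurd : ∀ {a b} → a ≤ b → {False (a ≤? b)} → ⊥
≤-absurd a≤b {a≰b} = toWitnessFalse a≰b a≤b

-- One step of the greedy algorithm, in coordinates where the chosen vertex sits at 0 and Y holds
-- the positions of the vertices of H.
record GreedyStep (o : Maybe ℕ) (Y : ℕ → Set) : Set where
  field
    centre width     : ℕ
    centre<width     : centre < width
    centre-occupied  : Y centre
    star-covers      : ∀ p → Y p → p < width → p ≢ centre → Link o centre p
    no-edge-beyond   : ∀ e → Y e → width ≤ e → ¬ Link o 0 e
    no-path-beyond   : ∀ c e → Y c → Y e → width ≤ e → Link o c 0 → ¬ Link o c e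
    shortcut-beyond  : ∀ c e₁ e₂ → Y c → c < width → Y e₁ → Y e₂ → width ≤ e₁ → width ≤ e₂ →
                       e₁ ≢ e₂ → Link o c e₁ → Link o c e₂ → Link o e₁ e₂

module GreedySteps (Y : ℕ → Set) where

  module Singleton (o : Maybe ℕ) (Y0 : Y 0) (¬Y1 : ¬ Y 1) (¬Y2 : o ≡ just 0 → ¬ Y 2) where
    covers : ∀ p → Y p → p < 1 → p ≢ 0 → Link o 0 p
    covers zero    _ _         p≢0 = ⊥-elim (p≢0 refl)
    covers (suc p) _ (s≤s ()) _

    no-edge : ∀ e → Y e → 1 ≤ e → ¬ Link o 0 e
    no-edge .1 Ye _ (inj₁ refl)                          = ¬Y1 Ye
    no-edge e  Ye _ (inj₂ (inj₁ ()))
    no-edge .2 Ye _ (inj₂ (inj₂ (inj₁ (o≡ , refl))))    = ¬Y2 o≡ Ye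
    no-edge e  Ye _ (inj₂ (inj₂ (inj₂ (_ , ()))))

    no-path : ∀ c e → Y c → Y e → 1 ≤ e → Link o c 0 → ¬ Link o c e
    no-path c  e Yc Ye _ (inj₁ ())
    no-path .1 e Yc Ye _ (inj₂ (inj₁ refl)) _                  = ¬Y1 Yc
    no-path c  e Yc Ye _ (inj₂ (inj₂ (inj₁ (_ , ()))))
    no-path .2 e Yc Ye _ (inj₂ (inj₂ (inj₂ (o≡ , refl)))) _    = ¬Y2 o≡ Yc

    shortcut : ∀ c e₁ e₂ → Y c → c < 1 → Y e₁ → Y e₂ → 1 ≤ e₁ → 1 ≤ e₂ → e₁ ≢ e₂ →
               Link o c e₁ → Link o c e₂ → Link o e₁ e₂
    shortcut zero    e₁ _ _ _        Ye₁ _ 1≤e₁ _ _ l _ = ⊥-elim (no-edge e₁ Ye₁ 1≤e₁ l)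
    shortcut (suc c) _  _ _ (s≤s ()) _   _ _    _ _ _ _

    step : GreedyStep o Y
    step = record { centre = 0 ; width = 1 ; centre<width = s≤s z≤n ; centre-occupied = Y0
                  ; star-covers = covers ; no-edge-beyond = no-edge ; no-path-beyond = no-path
                  ; shortcut-beyond = shortcut }

  module Path (o : Maybe ℕ) (Y1 : Y 1) (no-chord-at-1 : o ≢ just 1) (¬Y2 : o ≡ just 0 → ¬ Y 2) where
    covers : ∀ p → Y p → p < 3 → p ≢ 1 → Link o 1 p
    covers 0 _ _ _       = inj₂ (inj₁ refl)
    covers 1 _ _ p≢1     = ⊥-elim (p≢1 refl)
    covers 2 _ _ _       = inj₁ refl
    covers (suc (suc (suc p))) _ p<3 _ = ⊥-elim (≤-absurd p<3)

    no-edge : ∀ e → Y e → 3 ≤ e → ¬ Link o 0 e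
    no-edge .1 _ 3≤e (inj₁ refl)                          = ≤-absurd 3≤e
    no-edge e  _ _   (inj₂ (inj₁ ()))
    no-edge .2 _ 3≤e (inj₂ (inj₂ (inj₁ (_ , refl))))     = ≤-absurd 3≤e
    no-edge e  _ _   (inj₂ (inj₂ (inj₂ (_ , ()))))

    no-edge-from-1 : ∀ e → 3 ≤ e → ¬ Link o 1 e
    no-edge-from-1 .2 3≤e (inj₁ refl)                          = ≤-absurd 3≤e
    no-edge-from-1 .0 3≤e (inj₂ (inj₁ refl))                   = ≤-absurd 3≤e
    no-edge-from-1 e  _   (inj₂ (inj₂ (inj₁ (o≡ , _))))      = no-chord-at-1 o≡
    no-edge-from-1 e  _   (inj₂ (inj₂ (inj₂ (_ , ()))))

    no-path : ∀ c e → Y c → Y e → 3 ≤ e → Link o c 0 → ¬ Link o c e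
    no-path c  e Yc Ye _   (inj₁ ())
    no-path .1 e Yc Ye 3≤e (inj₂ (inj₁ refl))                     = no-edge-from-1 e 3≤e
    no-path c  e Yc Ye _   (inj₂ (inj₂ (inj₁ (_ , ()))))
    no-path .2 e Yc Ye _   (inj₂ (inj₂ (inj₂ (o≡ , refl)))) _    = ¬Y2 o≡ Yc

    neighbours-of-2 : ∀ e → 3 ≤ e → Link o 2 e → e ≡ 3 ⊎ e ≡ 4
    neighbours-of-2 .3 _   (inj₁ refl)                          = inj₁ refl
    neighbours-of-2 .1 3≤e (inj₂ (inj₁ refl))                   = ⊥-elim (≤-absurd 3≤e)
    neighbours-of-2 .4 _   (inj₂ (inj₂ (inj₁ (_ , refl))))     = inj₂ refl
    neighbours-of-2 .0 3≤e (inj₂ (inj₂ (inj₂ (_ , refl))))     = ⊥-elim (≤-absurd 3≤e)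

    shortcut : ∀ c e₁ e₂ → Y c → c < 3 → Y e₁ → Y e₂ → 3 ≤ e₁ → 3 ≤ e₂ → e₁ ≢ e₂ →
               Link o c e₁ → Link o c e₂ → Link o e₁ e₂
    shortcut 0 e₁ _ _ _ Ye₁ _ 3≤e₁ _ _ l _ = ⊥-elim (no-edge e₁ Ye₁ 3≤e₁ l)
    shortcut 1 e₁ _ _ _ _   _ 3≤e₁ _ _ l _ = ⊥-elim (no-edge-from-1 e₁ 3≤e₁ l)
    shortcut 2 e₁ e₂ _ _ _ _ 3≤e₁ 3≤e₂ e₁≢e₂ l₁ l₂
      with neighbours-of-2 e₁ 3≤e₁ l₁ | neighbours-of-2 e₂ 3≤e₂ l₂
    ... | inj₁ refl | inj₁ refl = ⊥-elim (e₁≢e₂ refl)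
    ... | inj₁ refl | inj₂ refl = inj₁ refl
    ... | inj₂ refl | inj₁ refl = inj₂ (inj₁ refl)
    ... | inj₂ refl | inj₂ refl = ⊥-elim (e₁≢e₂ refl)
    shortcut (suc (suc (suc c))) _ _ _ c<3 _ _ _ _ _ _ _ = ⊥-elim (≤-absurd c<3)

    step : GreedyStep o Y
    step = record { centre = 1 ; width = 3 ; centre<width = s≤s (s≤s z≤n) ; centre-occupied = Y1
                  ; star-covers = covers ; no-edge-beyond = no-edge ; no-path-beyond = no-path
                  ; shortcut-beyond = shortcut }

  module ChordAt1 (Y1 : Y 1) where
    o = just 1

    covers : ∀ p → Y p → p < 4 → p ≢ 1 → Link o 1 p
    covers 0 _ _ _   = inj₂ (inj₁ refl)
    covers 1 _ _ p≢1 = ⊥-elim (p≢1 refl)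
    covers 2 _ _ _   = inj₁ refl
    covers 3 _ _ _   = inj₂ (inj₂ (inj₁ (refl , refl)))
    covers (suc (suc (suc (suc p)))) _ p<4 _ = ⊥-elim (≤-absurd p<4)

    no-edge : ∀ e → Y e → 4 ≤ e → ¬ Link o 0 e
    no-edge .1 _ 4≤e (inj₁ refl) = ≤-absurd 4≤e
    no-edge e  _ _   (inj₂ (inj₁ ()))
    no-edge e  _ _   (inj₂ (inj₂ (inj₁ (() , _))))
    no-edge e  _ _   (inj₂ (inj₂ (inj₂ (_ , ()))))

    no-edge-from-1 : ∀ e → 4 ≤ e → ¬ Link o 1 e
    no-edge-from-1 .2 4≤e (inj₁ refl)                      = ≤-absurd 4≤e
    no-edge-from-1 .0 4≤e (inj₂ (inj₁ refl))               = ≤-absurd 4≤e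
    no-edge-from-1 .3 4≤e (inj₂ (inj₂ (inj₁ (_ , refl))))  = ≤-absurd 4≤e
    no-edge-from-1 e  _   (inj₂ (inj₂ (inj₂ (_ , ()))))

    no-edge-from-2 : ∀ e → 4 ≤ e → ¬ Link o 2 e
    no-edge-from-2 .3 4≤e (inj₁ refl)        = ≤-absurd 4≤e
    no-edge-from-2 .1 4≤e (inj₂ (inj₁ refl)) = ≤-absurd 4≤e
    no-edge-from-2 e  _   (inj₂ (inj₂ (inj₁ (() , _))))
    no-edge-from-2 .0 4≤e (inj₂ (inj₂ (inj₂ (_ , refl)))) = ≤-absurd 4≤e

    neighbour-of-3 : ∀ e → 4 ≤ e → Link o 3 e → e ≡ 4
    neighbour-of-3 .4 _   (inj₁ refl)                         = refl
    neighbour-of-3 .2 4≤e (inj₂ (inj₁ refl))                  = ⊥-elim (≤-absurd 4≤e)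
    neighbour-of-3 e  _   (inj₂ (inj₂ (inj₁ (() , _))))
    neighbour-of-3 .1 4≤e (inj₂ (inj₂ (inj₂ (_ , refl))))     = ⊥-elim (≤-absurd 4≤e)

    no-path : ∀ c e → Y c → Y e → 4 ≤ e → Link o c 0 → ¬ Link o c e
    no-path c  e _ _ _   (inj₁ ())
    no-path .1 e _ _ 4≤e (inj₂ (inj₁ refl)) = no-edge-from-1 e 4≤e
    no-path c  e _ _ _   (inj₂ (inj₂ (inj₁ (_ , ()))))
    no-path c  e _ _ _   (inj₂ (inj₂ (inj₂ (() , _))))

    shortcut : ∀ c e₁ e₂ → Y c → c < 4 → Y e₁ → Y e₂ → 4 ≤ e₁ → 4 ≤ e₂ → e₁ ≢ e₂ →
               Link o c e₁ → Link o c e₂ → Link o e₁ e₂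
    shortcut 0 e₁ _ _ _ Ye₁ _ 4≤e₁ _ _ l _ = ⊥-elim (no-edge e₁ Ye₁ 4≤e₁ l)
    shortcut 1 e₁ _ _ _ _   _ 4≤e₁ _ _ l _ = ⊥-elim (no-edge-from-1 e₁ 4≤e₁ l)
    shortcut 2 e₁ _ _ _ _   _ 4≤e₁ _ _ l _ = ⊥-elim (no-edge-from-2 e₁ 4≤e₁ l)
    shortcut 3 e₁ e₂ _ _ _ _ 4≤e₁ 4≤e₂ e₁≢e₂ l₁ l₂ =
      ⊥-elim (e₁≢e₂ (trans (neighbour-of-3 e₁ 4≤e₁ l₁) (sym (neighbour-of-3 e₂ 4≤e₂ l₂))))
    shortcut (suc (suc (suc (suc c)))) _ _ _ c<4 _ _ _ _ _ _ _ = ⊥-elim (≤-absurd c<4)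

    step : GreedyStep o Y
    step = record { centre = 1 ; width = 4 ; centre<width = s≤s (s≤s z≤n) ; centre-occupied = Y1
                  ; star-covers = covers ; no-edge-beyond = no-edge ; no-path-beyond = no-path
                  ; shortcut-beyond = shortcut }

  module Triangle (Y2 : Y 2) where
    o = just 0

    covers : ∀ p → Y p → p < 4 → p ≢ 2 → Link o 2 p
    covers 0 _ _ _   = inj₂ (inj₂ (inj₂ (refl , refl)))
    covers 1 _ _ _   = inj₂ (inj₁ refl)
    covers 2 _ _ p≢2 = ⊥-elim (p≢2 refl)
    covers 3 _ _ _   = inj₁ refl
    covers (suc (suc (suc (suc p)))) _ p<4 _ = ⊥-elim (≤-absurd p<4)

    no-edge : ∀ e → Y e → 4 ≤ e → ¬ Link o 0 e
    no-edge .1 _ 4≤e (inj₁ refl)                      = ≤-absurd 4≤e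
    no-edge e  _ _   (inj₂ (inj₁ ()))
    no-edge .2 _ 4≤e (inj₂ (inj₂ (inj₁ (_ , refl))))  = ≤-absurd 4≤e
    no-edge e  _ _   (inj₂ (inj₂ (inj₂ (_ , ()))))

    no-edge-from-1 : ∀ e → 4 ≤ e → ¬ Link o 1 e
    no-edge-from-1 .2 4≤e (inj₁ refl)        = ≤-absurd 4≤e
    no-edge-from-1 .0 4≤e (inj₂ (inj₁ refl)) = ≤-absurd 4≤e
    no-edge-from-1 e  _   (inj₂ (inj₂ (inj₁ (() , _))))
    no-edge-from-1 e  _   (inj₂ (inj₂ (inj₂ (_ , ()))))

    no-edge-from-2 : ∀ e → 4 ≤ e → ¬ Link o 2 e
    no-edge-from-2 .3 4≤e (inj₁ refl)                     = ≤-absurd 4≤e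
    no-edge-from-2 .1 4≤e (inj₂ (inj₁ refl))              = ≤-absurd 4≤e
    no-edge-from-2 e  _   (inj₂ (inj₂ (inj₁ (() , _))))
    no-edge-from-2 .0 4≤e (inj₂ (inj₂ (inj₂ (_ , refl)))) = ≤-absurd 4≤e

    neighbour-of-3 : ∀ e → 4 ≤ e → Link o 3 e → e ≡ 4
    neighbour-of-3 .4 _   (inj₁ refl)        = refl
    neighbour-of-3 .2 4≤e (inj₂ (inj₁ refl)) = ⊥-elim (≤-absurd 4≤e)
    neighbour-of-3 e  _   (inj₂ (inj₂ (inj₁ (() , _))))
    neighbour-of-3 .1 4≤e (inj₂ (inj₂ (inj₂ (_ , refl)))) = ⊥-elim (≤-absurd 4≤e)

    no-path : ∀ c e → Y c → Y e → 4 ≤ e → Link o c 0 → ¬ Link o c e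
    no-path c  e _ _ _   (inj₁ ())
    no-path .1 e _ _ 4≤e (inj₂ (inj₁ refl))                 = no-edge-from-1 e 4≤e
    no-path c  e _ _ _   (inj₂ (inj₂ (inj₁ (_ , ()))))
    no-path .2 e _ _ 4≤e (inj₂ (inj₂ (inj₂ (_ , refl))))    = no-edge-from-2 e 4≤e

    shortcut : ∀ c e₁ e₂ → Y c → c < 4 → Y e₁ → Y e₂ → 4 ≤ e₁ → 4 ≤ e₂ → e₁ ≢ e₂ →
               Link o c e₁ → Link o c e₂ → Link o e₁ e₂
    shortcut 0 e₁ _ _ _ Ye₁ _ 4≤e₁ _ _ l _ = ⊥-elim (no-edge e₁ Ye₁ 4≤e₁ l)
    shortcut 1 e₁ _ _ _ _   _ 4≤e₁ _ _ l _ = ⊥-elim (no-edge-from-1 e₁ 4≤e₁ l)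
    shortcut 2 e₁ _ _ _ _   _ 4≤e₁ _ _ l _ = ⊥-elim (no-edge-from-2 e₁ 4≤e₁ l)
    shortcut 3 e₁ e₂ _ _ _ _ 4≤e₁ 4≤e₂ e₁≢e₂ l₁ l₂ =
      ⊥-elim (e₁≢e₂ (trans (neighbour-of-3 e₁ 4≤e₁ l₁) (sym (neighbour-of-3 e₂ 4≤e₂ l₂))))
    shortcut (suc (suc (suc (suc c)))) _ _ _ c<4 _ _ _ _ _ _ _ = ⊥-elim (≤-absurd c<4)

    step : GreedyStep o Y
    step = record { centre = 2 ; width = 4 ; centre<width = s≤s (s≤s (s≤s z≤n)) ; centre-occupied = Y2
                  ; star-covers = covers ; no-edge-beyond = no-edge ; no-path-beyond = no-path
                  ; shortcut-beyond = shortcut }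

greedyStep : (o : Maybe ℕ) (Y : ℕ → Set) → Decidable Y → Y 0 → GreedyStep o Y
greedyStep (just 0) Y Y? Y0 with Y? 2
... | yes Y2 = GreedySteps.Triangle.step Y Y2
... | no ¬Y2 with Y? 1
...   | yes Y1 = GreedySteps.Path.step Y (just 0) Y1 (λ ()) (λ _ → ¬Y2)
...   | no ¬Y1 = GreedySteps.Singleton.step Y (just 0) Y0 ¬Y1 (λ _ → ¬Y2)
greedyStep (just 1) Y Y? Y0 with Y? 1
... | yes Y1 = GreedySteps.ChordAt1.step Y Y1
... | no ¬Y1 = GreedySteps.Singleton.step Y (just 1) Y0 ¬Y1 (λ ())
greedyStep (just (suc (suc j))) Y Y? Y0 with Y? 1
... | yes Y1 = GreedySteps.Path.step Y _ Y1 (λ ()) (λ ())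
... | no ¬Y1 = GreedySteps.Singleton.step Y _ Y0 ¬Y1 (λ ())
greedyStep nothing Y Y? Y0 with Y? 1
... | yes Y1 = GreedySteps.Path.step Y _ Y1 (λ ()) (λ ())
... | no ¬Y1 = GreedySteps.Singleton.step Y _ Y0 ¬Y1 (λ ())

-- Moving the new vertex m of P_m^* between i and i + 1 (and shifting i + 1, …, m - 1 up by one)
-- turns P_m^* into Link (just i) on the positions 0, …, m.
module Relabelling (m i : ℕ) (i+1<m : suc i < m) where

  relabel : ℕ → ℕ
  relabel v with v ≟ m | v ≤? i
  ... | yes _ | _     = suc i
  ... | no _  | yes _ = v
  ... | no _  | no _  = suc v

  data RelabelView (v : ℕ) : ℕ → Set where
    new  : v ≡ m → RelabelView v (suc i)
    low  : v ≤ i → RelabelView v v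
    high : i < v → v < m → RelabelView v (suc v)

  relabel-view : ∀ v → v ≤ m → RelabelView v (relabel v)
  relabel-view v v≤m with v ≟ m | v ≤? i
  ... | yes v≡m | _     = new v≡m
  ... | no v≢m  | yes v≤i = low v≤i
  ... | no v≢m  | no v≰i  = high (≰⇒> v≰i) (≤∧≢⇒< v≤m v≢m)

  i<m : i < m
  i<m = ≤-trans (n≤1+n _) i+1<m

  relabel-injective : ∀ a b → a ≤ m → b ≤ m → relabel a ≡ relabel b → a ≡ b
  relabel-injective a b a≤m b≤m eq with relabel a | relabel-view a a≤m | relabel b | relabel-view b b≤m
  ... | _ | new refl     | _ | new refl     = refl
  ... | _ | new _        | _ | low b≤i      = ⊥-elim (1+n≰n (subst (_≤ i) (sym eq) b≤i))
  ... | _ | new _        | _ | high i<b _   = ⊥-elim (<⇒≢ i<b (suc-injective eq))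
  ... | _ | low a≤i      | _ | new _        = ⊥-elim (1+n≰n (subst (_≤ i) eq a≤i))
  ... | _ | low _        | _ | low _        = eq
  ... | _ | low a≤i      | _ | high i<b _   = ⊥-elim (1+n≰n (≤-trans (subst (_≤ i) eq a≤i) (<⇒≤ i<b)))
  ... | _ | high i<a _   | _ | new _        = ⊥-elim (<⇒≢ i<a (sym (suc-injective eq)))
  ... | _ | high i<a _   | _ | low b≤i      = ⊥-elim (1+n≰n (≤-trans (subst (_≤ i) (sym eq) b≤i) (<⇒≤ i<a)))
  ... | _ | high _ _     | _ | high _ _     = suc-injective eq

  relabel≤m : ∀ v → v ≤ m → relabel v ≤ m
  relabel≤m v v≤m with relabel v | relabel-view v v≤m
  ... | _ | new _      = i<m
  ... | _ | low _      = v≤m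
  ... | _ | high _ v<m = v<m

  relabel-m : relabel m ≡ suc i
  relabel-m with relabel m | relabel-view m ≤-refl
  ... | _ | new _      = refl
  ... | _ | low m≤i    = ⊥-elim (<⇒≱ i<m m≤i)
  ... | _ | high _ m<m = ⊥-elim (<-irrefl refl m<m)

  relabel-low : ∀ {v} → v ≤ i → relabel v ≡ v
  relabel-low {v} v≤i with relabel v | relabel-view v (≤-trans v≤i (<⇒≤ i<m))
  ... | _ | new refl   = ⊥-elim (<⇒≱ i<m v≤i)
  ... | _ | low _      = refl
  ... | _ | high i<v _ = ⊥-elim (<⇒≱ i<v v≤i)

  relabel-high : ∀ {v} → i < v → v < m → relabel v ≡ suc v
  relabel-high {v} i<v v<m with relabel v | relabel-view v (<⇒≤ v<m)
  ... | _ | new refl   = ⊥-elim (<-irrefl refl v<m)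
  ... | _ | low v≤i    = ⊥-elim (<⇒≱ i<v v≤i)
  ... | _ | high _ _   = refl

  path-edge : ∀ a → suc a < m → Link (just i) (relabel a) (relabel (suc a))
  path-edge a a+1<m with <-cmp a i
  ... | tri< a<i _ _ rewrite relabel-low (<⇒≤ a<i) | relabel-low a<i = inj₁ refl
  ... | tri≈ _ refl _ rewrite relabel-low {a} ≤-refl | relabel-high (n<1+n a) a+1<m =
    inj₂ (inj₂ (inj₁ (refl , refl)))
  ... | tri> _ _ i<a rewrite relabel-high i<a (<-trans (n<1+n a) a+1<m)
                           | relabel-high (<-trans i<a (n<1+n a)) a+1<m = inj₁ refl

  SPAdj⇒Link : ∀ a b → SPAdjℕ m i a b → Link (just i) (relabel a) (relabel b)
  SPAdj⇒Link a .(suc a) (inj₁ (_ , a+1<m , inj₁ refl)) = path-edge a a+1<m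
  SPAdj⇒Link .(suc b) b (inj₁ (b+1<m , _ , inj₂ refl)) = Link-sym (path-edge b b+1<m)
  SPAdj⇒Link .m .i (inj₂ (inj₁ (refl , inj₁ refl)))
    rewrite relabel-m | relabel-low {i} ≤-refl = inj₂ (inj₁ refl)
  SPAdj⇒Link .m .(suc i) (inj₂ (inj₁ (refl , inj₂ refl)))
    rewrite relabel-m | relabel-high (n<1+n i) i+1<m = inj₁ refl
  SPAdj⇒Link .i .m (inj₂ (inj₂ (refl , inj₁ refl)))
    rewrite relabel-m | relabel-low {i} ≤-refl = inj₁ refl
  SPAdj⇒Link .(suc i) .m (inj₂ (inj₂ (refl , inj₂ refl)))
    rewrite relabel-m | relabel-high (n<1+n i) i+1<m = inj₂ (inj₁ refl)

  private
    2+n≰n : ∀ {n} → ¬ 2 + n ≤ n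
    2+n≰n 2+n≤n = 1+n≰n (≤-trans (n≤1+n _) 2+n≤n)

    new-new : ¬ Link (just i) (suc i) (suc i)
    new-new (inj₁ ())
    new-new (inj₂ (inj₁ ()))
    new-new (inj₂ (inj₂ (inj₁ (() , _))))
    new-new (inj₂ (inj₂ (inj₂ (() , _))))

    new-low : ∀ b → b ≤ i → Link (just i) (suc i) b → b ≡ i
    new-low .(2 + i) b≤i (inj₁ refl)                       = ⊥-elim (2+n≰n b≤i)
    new-low b        _   (inj₂ (inj₁ refl))                = refl
    new-low b        _   (inj₂ (inj₂ (inj₁ (() , _))))
    new-low b        _   (inj₂ (inj₂ (inj₂ (refl , ()))))

    new-high : ∀ b → i < b → Link (just i) (suc i) (suc b) → b ≡ suc i
    new-high b _   (inj₁ refl)                      = refl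
    new-high b i<b (inj₂ (inj₁ refl))               = ⊥-elim (1+n≰n (≤-trans (n≤1+n _) i<b))
    new-high b _   (inj₂ (inj₂ (inj₁ (() , _))))
    new-high b _   (inj₂ (inj₂ (inj₂ (refl , ()))))

    low-low : ∀ a b → a ≤ i → b ≤ i → Link (just i) a b → suc a ≡ b ⊎ suc b ≡ a
    low-low a b _   _   (inj₁ e)                          = inj₁ e
    low-low a b _   _   (inj₂ (inj₁ e))                   = inj₂ e
    low-low a b _   b≤i (inj₂ (inj₂ (inj₁ (refl , refl)))) = ⊥-elim (2+n≰n b≤i)
    low-low a b a≤i _   (inj₂ (inj₂ (inj₂ (refl , refl)))) = ⊥-elim (2+n≰n a≤i)

    low-high : ∀ a b → a ≤ i → i < b → Link (just i) a (suc b) → suc a ≡ b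
    low-high a b a≤i i<b (inj₁ refl)                       = ⊥-elim (1+n≰n (≤-trans i<b a≤i))
    low-high a b a≤i i<b (inj₂ (inj₁ refl))                = ⊥-elim (1+n≰n (≤-trans (≤-trans i<b (n≤1+n _)) (≤-trans (n≤1+n _) a≤i)))
    low-high a b _   _   (inj₂ (inj₂ (inj₁ (refl , refl)))) = refl
    low-high a b a≤i _   (inj₂ (inj₂ (inj₂ (refl , refl)))) = ⊥-elim (2+n≰n a≤i)

    high-high : ∀ a b → i < a → i < b → Link (just i) (suc a) (suc b) → suc a ≡ b ⊎ suc b ≡ a
    high-high a b _   _   (inj₁ refl)                       = inj₁ refl
    high-high a b _   _   (inj₂ (inj₁ refl))                = inj₂ refl
    high-high a b i<a _   (inj₂ (inj₂ (inj₁ (refl , _))))   = ⊥-elim (1+n≰n (≤-trans (n≤1+n _) i<a))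
    high-high a b _   i<b (inj₂ (inj₂ (inj₂ (refl , refl)))) = ⊥-elim (1+n≰n (≤-trans (n≤1+n _) i<b))

    low<m : ∀ {a} → a ≤ i → a < m
    low<m a≤i = ≤-<-trans a≤i i<m

  Link⇒SPAdj : ∀ a b → a ≤ m → b ≤ m → Link (just i) (relabel a) (relabel b) → SPAdjℕ m i a b
  Link⇒SPAdj a b a≤m b≤m l with relabel a | relabel-view a a≤m | relabel b | relabel-view b b≤m
  ... | _ | new _          | _ | new _          = ⊥-elim (new-new l)
  ... | _ | new a≡m        | _ | low b≤i        = inj₂ (inj₁ (a≡m , inj₁ (new-low b b≤i l)))
  ... | _ | new a≡m        | _ | high i<b _     = inj₂ (inj₁ (a≡m , inj₂ (new-high b i<b l)))
  ... | _ | low a≤i        | _ | new b≡m        = inj₂ (inj₂ (b≡m , inj₁ (new-low a a≤i (Link-sym l))))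
  ... | _ | high i<a _     | _ | new b≡m        = inj₂ (inj₂ (b≡m , inj₂ (new-high a i<a (Link-sym l))))
  ... | _ | low a≤i        | _ | low b≤i        = inj₁ (low<m a≤i , low<m b≤i , low-low a b a≤i b≤i l)
  ... | _ | low a≤i        | _ | high i<b b<m   = inj₁ (low<m a≤i , b<m , inj₁ (low-high a b a≤i i<b l))
  ... | _ | high i<a a<m   | _ | low b≤i        = inj₁ (a<m , low<m b≤i , inj₂ (low-high b a b≤i i<a (Link-sym l)))
  ... | _ | high i<a a<m   | _ | high i<b b<m   = inj₁ (a<m , b<m , high-high a b i<a i<b l)

chordFrom : ℕ → ℕ → Maybe ℕ
chordFrom i x with x ≤? i
... | yes _ = just (i ∸ x)
... | no _  = nothing

chordFrom-just : ∀ {i x a} → chordFrom i x ≡ just a → i ≡ a + x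
chordFrom-just {i} {x} eq with x ≤? i
chordFrom-just {i} {x} refl | yes x≤i = sym (m∸n+n≡m x≤i)

chord-unshift : ∀ x a b → b + x ≡ 2 + (a + x) → Chord (chordFrom (a + x) x) a b
chord-unshift x a b e with x ≤? a + x
... | yes _    = cong just (m+n∸n≡m a x) , +-cancelʳ-≡ x b (2 + a) e
... | no x≰a+x = ⊥-elim (x≰a+x (m≤n+m x a))

Link-unshift : ∀ {i} x a b → Link (just i) (a + x) (b + x) → Link (chordFrom i x) a b
Link-unshift x a b (inj₁ e)                         = inj₁ (+-cancelʳ-≡ x (suc a) b e)
Link-unshift x a b (inj₂ (inj₁ e))                  = inj₂ (inj₁ (+-cancelʳ-≡ x (suc b) a e))
Link-unshift x a b (inj₂ (inj₂ (inj₁ (refl , e)))) = inj₂ (inj₂ (inj₁ (chord-unshift x a b e)))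
Link-unshift x a b (inj₂ (inj₂ (inj₂ (refl , e)))) = inj₂ (inj₂ (inj₂ (chord-unshift x b a e)))

Link-shift : ∀ {i} x a b → Link (chordFrom i x) a b → Link (just i) (a + x) (b + x)
Link-shift x a b (inj₁ refl)        = inj₁ refl
Link-shift x a b (inj₂ (inj₁ refl)) = inj₂ (inj₁ refl)
Link-shift x a b (inj₂ (inj₂ (inj₁ (eq , refl)))) = inj₂ (inj₂ (inj₁ (cong just (chordFrom-just eq) , refl)))
Link-shift x a b (inj₂ (inj₂ (inj₂ (eq , refl)))) = inj₂ (inj₂ (inj₂ (cong just (chordFrom-just eq) , refl)))

module Greedy (m i : ℕ) (i+1<m : suc i < m) (H : Subset (suc m)) where
  open Relabelling m i i+1<m

  Adj : Fin (suc m) → Fin (suc m) → Set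
  Adj = SpecialPathAdj m i

  pos : Fin (suc m) → ℕ
  pos q = relabel (toℕ q)

  pos-injective : ∀ {q r} → pos q ≡ pos r → q ≡ r
  pos-injective {q} {r} eq = Finₚ.toℕ-injective (relabel-injective _ _ (Finₚ.toℕ≤pred[n] q) (Finₚ.toℕ≤pred[n] r) eq)

  Adj⇒Link : ∀ {u v} → Adj u v → Link (just i) (pos u) (pos v)
  Adj⇒Link {u} {v} = SPAdj⇒Link (toℕ u) (toℕ v)

  Link⇒Adj : ∀ {u v} → Link (just i) (pos u) (pos v) → Adj u v
  Link⇒Adj {u} {v} = Link⇒SPAdj _ _ (Finₚ.toℕ≤pred[n] u) (Finₚ.toℕ≤pred[n] v)

  Occupied : ℕ → Set
  Occupied p = Σ (Fin (suc m)) λ q → q ∈ H × pos q ≡ p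

  occupied? : Decidable Occupied
  occupied? p = Finₚ.any? (λ q → (q ∈? H) ×-dec (pos q ≟ p))

  occupied⇒≤m : ∀ {p} → Occupied p → p ≤ m
  occupied⇒≤m (q , _ , refl) = relabel≤m _ (Finₚ.toℕ≤pred[n] q)

  Near : ℕ → ℕ → ℕ → Set
  Near k a b = Link (just i) a b ⊎ Σ ℕ λ c → Occupied c × k ≤ c × Link (just i) c a × Link (just i) c b

  Near-sym : ∀ {k a b} → Near k a b → Near k b a
  Near-sym (inj₁ l)                      = inj₁ (Link-sym l)
  Near-sym (inj₂ (c , Xc , k≤c , l , l′)) = inj₂ (c , Xc , k≤c , l′ , l)

  Star′ : Set
  Star′ = Star Adj H

  -- Separation only accounts for common neighbours from k on; `shortcut-beyond` keeps this sound
  -- when a greedy step moves k to the left.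
  record Partial (k : ℕ) : Set where
    field
      chosen    : List (Fin (suc m))
      stars     : Vec Star′ (length chosen)
      chosen⊆H  : All (λ q → q ∈ H × k ≤ pos q) chosen
      unique    : Unique chosen
      separated : ∀ u v → u ∈ₗ chosen → v ∈ₗ chosen → u ≢ v → ¬ Near k (pos u) (pos v)
      covers    : ∀ q → q ∈ H → k ≤ pos q → ∃ λ s → s VecMem.∈ stars × InStar Adj s q

  empty : ∀ k → (∀ p → k ≤ p → ¬ Occupied p) → Partial k
  empty k unoccupied = record
    { chosen = [] ; stars = [] ; chosen⊆H = [] ; unique = [] ; separated = λ _ _ ()
    ; covers = λ q q∈H k≤q → ⊥-elim (unoccupied (pos q) k≤q (q , q∈H , refl)) }

  skip : ∀ {k} → ¬ Occupied k → Partial (suc k) → Partial k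
  skip {k} ¬Xk r = record
    { chosen = chosen ; stars = stars
    ; chosen⊆H = All.map (map₂ (≤-trans (n≤1+n k))) chosen⊆H ; unique = unique
    ; separated = λ u v u∈ v∈ u≢v → separated u v u∈ v∈ u≢v ∘ near-beyond
    ; covers = λ q q∈H k≤q → covers q q∈H (beyond (q , q∈H , refl) k≤q) }
    where
    open Partial r
    beyond : ∀ {p} → Occupied p → k ≤ p → suc k ≤ p
    beyond Xp k≤p = ≤∧≢⇒< k≤p λ { refl → ¬Xk Xp }
    near-beyond : ∀ {a b} → Near k a b → Near (suc k) a b
    near-beyond (inj₁ l)                      = inj₁ l
    near-beyond (inj₂ (c , Xc , k≤c , l , l′)) = inj₂ (c , Xc , beyond Xc k≤c , l , l′)

  module Extend (x : ℕ) (Xx : Occupied x) (step : GreedyStep (chordFrom i x) (λ e → Occupied (e + x))) where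
    open GreedyStep step

    o : Maybe ℕ
    o = chordFrom i x

    chosenVertex centreVertex : Fin (suc m)
    chosenVertex = proj₁ Xx
    centreVertex = proj₁ centre-occupied

    pos-centre : pos centreVertex ≡ centre + x
    pos-centre = proj₂ (proj₂ centre-occupied)

    x≤width+x : x ≤ width + x
    x≤width+x = m≤n+m x width

    toFrame : ∀ {a b} → x ≤ a → x ≤ b → Link (just i) a b → Link o (a ∸ x) (b ∸ x)
    toFrame x≤a x≤b l = Link-unshift x _ _ (subst₂ (Link (just i)) (sym (m∸n+n≡m x≤a)) (sym (m∸n+n≡m x≤b)) l)

    fromFrame : ∀ {a b} → x ≤ a → x ≤ b → Link o (a ∸ x) (b ∸ x) → Link (just i) a b
    fromFrame x≤a x≤b l = subst₂ (Link (just i)) (m∸n+n≡m x≤a) (m∸n+n≡m x≤b) (Link-shift x _ _ l)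

    toFrame-occupied : ∀ {a} → x ≤ a → Occupied a → Occupied (a ∸ x + x)
    toFrame-occupied x≤a = subst Occupied (sym (m∸n+n≡m x≤a))

    width≤∸ : ∀ {a} → width + x ≤ a → width ≤ a ∸ x
    width≤∸ {a} le = subst (_≤ a ∸ x) (m+n∸n≡m width x) (∸-monoˡ-≤ x le)

    ∸<width : ∀ {a} → x ≤ a → a < width + x → a ∸ x < width
    ∸<width {a} x≤a lt = +-cancelʳ-≤ x (suc (a ∸ x)) width (subst (λ z → suc z ≤ width + x) (sym (m∸n+n≡m x≤a)) lt)

    IsLeaf : Fin (suc m) → Set
    IsLeaf q = q ∈ H × x ≤ pos q × pos q < width + x × q ≢ centreVertex

    isLeaf? : Decidable IsLeaf
    isLeaf? q = (q ∈? H) ×-dec ((x ≤? pos q) ×-dec ((suc (pos q) ≤? width + x) ×-dec ¬? (q Fin.≟ centreVertex)))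

    leaf-adjacent : ∀ {q} → IsLeaf q → Adj centreVertex q
    leaf-adjacent {q} (q∈H , x≤q , q<w , q≢c) =
      Link⇒Adj (subst₂ (Link (just i)) (sym pos-centre) (m∸n+n≡m x≤q)
        (Link-shift x centre _ (star-covers _ (q , q∈H , sym (m∸n+n≡m x≤q)) (∸<width x≤q q<w) q∸x≢centre)))
      where
      q∸x≢centre : pos q ∸ x ≢ centre
      q∸x≢centre eq = q≢c (pos-injective (trans (sym (m∸n+n≡m x≤q)) (trans (cong (_+ x) eq) (sym pos-centre))))

    leaves : List (Fin (suc m))
    leaves = filter isLeaf? (allFin (suc m))

    star : Star′
    star = record
      { centre = centreVertex ; leaves = leaves ; centre∈H = proj₁ (proj₂ centre-occupied)
      ; leaves∈H = All.map proj₁ (all-filter isLeaf? (allFin (suc m)))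
      ; leavesAdj = All.map leaf-adjacent (all-filter isLeaf? (allFin (suc m)))
      ; leavesDist = filter⁺ isLeaf? (allFin⁺ (suc m))
      ; centre∉ = λ c∈ → proj₂ (proj₂ (proj₂ (proj₂ (∈-filter⁻ isLeaf? {xs = allFin (suc m)} c∈)))) refl }

    in-star : ∀ q → q ∈ H → x ≤ pos q → pos q < width + x → InStar Adj star q
    in-star q q∈H x≤q q<w with q Fin.≟ centreVertex
    ... | yes q≡c = inj₁ q≡c
    ... | no q≢c  = inj₂ (∈-filter⁺ isLeaf? (∈-allFin q) (q∈H , x≤q , q<w , q≢c))

    chosen-far : ∀ y → Occupied y → width + x ≤ y → ¬ Near x x y
    chosen-far y Xy w≤y (inj₁ l) =
      no-edge-beyond (y ∸ x) (toFrame-occupied x≤y Xy) (width≤∸ w≤y)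
        (subst (λ z → Link o z (y ∸ x)) (n∸n≡0 x) (toFrame ≤-refl x≤y l))
      where x≤y = ≤-trans x≤width+x w≤y
    chosen-far y Xy w≤y (inj₂ (c , Xc , x≤c , l₀ , l)) =
      no-path-beyond (c ∸ x) (y ∸ x) (toFrame-occupied x≤c Xc) (toFrame-occupied x≤y Xy) (width≤∸ w≤y)
        (subst (Link o (c ∸ x)) (n∸n≡0 x) (toFrame x≤c ≤-refl l₀)) (toFrame x≤c x≤y l)
      where x≤y = ≤-trans x≤width+x w≤y

    near-beyond : ∀ a b → Occupied a → Occupied b → width + x ≤ a → width + x ≤ b → a ≢ b →
                  Near x a b → Near (width + x) a b
    near-beyond a b _ _ _ _ _ (inj₁ l) = inj₁ l
    near-beyond a b Xa Xb w≤a w≤b a≢b (inj₂ (c , Xc , x≤c , l₁ , l₂)) with width + x ≤? c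
    ... | yes w≤c = inj₂ (c , Xc , w≤c , l₁ , l₂)
    ... | no w≰c  = inj₁ (fromFrame x≤a x≤b
          (shortcut-beyond (c ∸ x) (a ∸ x) (b ∸ x) (toFrame-occupied x≤c Xc) (∸<width x≤c (≰⇒> w≰c))
            (toFrame-occupied x≤a Xa) (toFrame-occupied x≤b Xb) (width≤∸ w≤a) (width≤∸ w≤b) a∸x≢b∸x
            (toFrame x≤c x≤a l₁) (toFrame x≤c x≤b l₂)))
      where
      x≤a = ≤-trans x≤width+x w≤a
      x≤b = ≤-trans x≤width+x w≤b
      a∸x≢b∸x : a ∸ x ≢ b ∸ x
      a∸x≢b∸x eq = a≢b (trans (sym (m∸n+n≡m x≤a)) (trans (cong (_+ x) eq) (m∸n+n≡m x≤b)))

    extend : Partial (width + x) → Partial x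
    extend r = record
      { chosen = chosenVertex ∷ chosen ; stars = star ∷ stars
      ; chosen⊆H = (proj₁ (proj₂ Xx) , ≤-reflexive (sym (proj₂ (proj₂ Xx))))
                   ∷ All.map (λ (q∈H , w≤q) → q∈H , ≤-trans x≤width+x w≤q) chosen⊆H
      ; unique = All.map chosen≢later chosen⊆H ∷ unique
      ; separated = separated′
      ; covers = covers′ }
      where
      open Partial r
      pos-chosen : pos chosenVertex ≡ x
      pos-chosen = proj₂ (proj₂ Xx)

      chosen≢later : ∀ {v} → v ∈ H × width + x ≤ pos v → chosenVertex ≢ v
      chosen≢later (_ , w≤v) refl =
        1+n≰n (≤-trans (+-monoˡ-≤ x (≤-trans (s≤s z≤n) centre<width)) (subst (width + x ≤_) pos-chosen w≤v))

      chosen-separated : ∀ v → v ∈ₗ chosen → ¬ Near x (pos chosenVertex) (pos v)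
      chosen-separated v v∈ near with All.lookup chosen⊆H v∈
      ... | v∈H , w≤v = chosen-far (pos v) (v , v∈H , refl) w≤v (subst (λ z → Near x z (pos v)) pos-chosen near)

      separated′ : ∀ u v → u ∈ₗ chosenVertex ∷ chosen → v ∈ₗ chosenVertex ∷ chosen → u ≢ v →
                   ¬ Near x (pos u) (pos v)
      separated′ u v (here refl)  (here refl)  u≢v = ⊥-elim (u≢v refl)
      separated′ u v (here refl)  (there v∈) _    = chosen-separated v v∈
      separated′ u v (there u∈) (here refl)  _    = chosen-separated u u∈ ∘ Near-sym
      separated′ u v (there u∈) (there v∈) u≢v near with All.lookup chosen⊆H u∈ | All.lookup chosen⊆H v∈
      ... | u∈H , w≤u | v∈H , w≤v =
        separated u v u∈ v∈ u≢v
          (near-beyond (pos u) (pos v) (u , u∈H , refl) (v , v∈H , refl) w≤u w≤v (u≢v ∘ pos-injective) near)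

      covers′ : ∀ q → q ∈ H → x ≤ pos q → ∃ λ s → s VecMem.∈ (star ∷ stars) × InStar Adj s q
      covers′ q q∈H x≤q with width + x ≤? pos q
      ... | yes w≤q = let (s , s∈ , q∈s) = covers q q∈H w≤q in s , VecAny.there s∈ , q∈s
      ... | no w≰q  = star , VecAny.here refl , in-star q q∈H x≤q (≰⇒> w≰q)

  greedy : ∀ f k → m < k + f → Partial k
  greedy zero k m<k+0 = empty k λ p k≤p Xp →
    <⇒≱ (≤-trans (subst (m <_) (+-identityʳ k) m<k+0) k≤p) (occupied⇒≤m Xp)
  greedy (suc f) k m<k+1+f with occupied? k
  ... | no ¬Xk = skip ¬Xk (greedy f (suc k) (subst (m <_) (+-suc k f) m<k+1+f))
  ... | yes Xk = Extend.extend k Xk step (greedy f (width + k) m<width+k+f)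
    where
    step : GreedyStep (chordFrom i k) (λ e → Occupied (e + k))
    step = greedyStep (chordFrom i k) (λ e → Occupied (e + k)) (λ e → occupied? (e + k)) Xk
    open GreedyStep step using (width; centre<width)
    m<width+k+f : m < width + k + f
    m<width+k+f = ≤-trans m<k+1+f (subst (_≤ width + k + f) (sym (+-suc k f))
                    (+-monoˡ-≤ f (+-monoˡ-≤ k (≤-trans (s≤s z≤n) centre<width))))

  solution : Partial 0
  solution = greedy (suc m) 0 ≤-refl

  open Partial solution

  star-mates-near : (s : Star′) → ∀ {u v} → InStar Adj s u → InStar Adj s v → u ≢ v → Near 0 (pos u) (pos v)
  star-mates-near s (inj₁ refl) (inj₁ refl) u≢v = ⊥-elim (u≢v refl)
  star-mates-near s (inj₁ refl) (inj₂ v∈)   _   = inj₁ (Adj⇒Link (All.lookup (Star.leavesAdj s) v∈))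
  star-mates-near s (inj₂ u∈)   (inj₁ refl) _   = inj₁ (Link-sym (Adj⇒Link (All.lookup (Star.leavesAdj s) u∈)))
  star-mates-near s (inj₂ u∈)   (inj₂ v∈)   _   =
    inj₂ (pos (Star.centre s) , (Star.centre s , Star.centre∈H s , refl) , z≤n ,
          Adj⇒Link (All.lookup (Star.leavesAdj s) u∈) , Adj⇒Link (All.lookup (Star.leavesAdj s) v∈))

  solution-independent : SIndependent Adj H chosen
  solution-independent = unique , All.map proj₁ chosen⊆H ,
    λ u v u∈ v∈ u≢v (s , u∈s , v∈s) → separated u v u∈ v∈ u≢v (star-mates-near s u∈s v∈s u≢v)

  solution-cover : StarCover Adj H (length chosen)
  solution-cover = stars , λ q q∈H → covers q q∈H z≤n

lemma2p13 : (m i : ℕ) → suc i < m → SPerfect (SpecialPathAdj m i)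
lemma2p13 m i i+1<m = SPerfect-from-certificates (SpecialPathAdj m i) λ H →
  let open Greedy m i i+1<m H in Partial.chosen solution , solution-independent , solution-cover
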